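{- Let $k \ge 1$ be an integer and let $N$ be an integer with $3^{k-1} < N \le 3^k$. Then $$k+1 \le a(N) \le 2k,\qquad k+1 \le r(N) \le 2k,\qquad k \le f(N) \le 2k-1.$$
   Context: Setting (alternator coin problem): There are $N$ identical-looking coins. All but one are real and have the same weight. The remaining coin, the alternator, behaves as follows: each time it is placed on a balance scale it weighs either the same as a real coin ("acts real") or strictly less than a real coin ("acts fake"), and it switches between these two behaviours every time it is on the scale; while it is off the scale its behaviour does not change. A weighing places two disjoint sets of coins with the same number of coins on the two pans, and its outcome is one of: the pans balance, the left pan is lighter, or the right pan is lighter. Weighings may be chosen adaptively based on earlier outcomes. A strategy finds the alternator if, for every possible identity of the alternator, the outcomes determine which coin it is. The alternator is in the $f$-state if the next time it is on the scale it will act fake, and in the $r$-state if the next time it is on the scale it will act real. Define $f(N)$ (resp. $r(N)$) as the smallest number of weighings that guarantees finding the alternator among $N$ coins when the alternator starts in the $f$-state (resp. $r$-state), and $a(N)$ as the smallest number of weighings that guarantees finding it when its starting state is unknown (it may be either). -}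

module Defs where

open import Data.Nat using (ℕ; zero; suc)
open import Data.Fin using (Fin; zero; suc)
open import Data.Bool using (Bool; true; false; if_then_else_)
open import Data.Product using (Σ)
open import Relation.Binary.PropositionalEquality using (_≡_)

data Pan : Set where
  left right off : Pan

isLeft : Pan → Bool
isLeft left = true
isLeft _    = false

isRight : Pan → Bool
isRight right = true
isRight _     = false

count : ∀ {n} → (Fin n → Bool) → ℕ
count {zero}  p = zero
count {suc n} p = if p zero then suc (count (λ i → p (suc i))) else count (λ i → p (suc i))

record Weighing (N : ℕ) : Set where
  constructor weighing
  field
    place    : Fin N → Pan
    balanced : count (λ i → isLeft (place i)) ≡ count (λ i → isRight (place i))
open Weighing public

data Outcome : Set where
  balance leftLighter rightLighter : Outcome

-- Alternator state: true = f-state (acts fake next time on the scale),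
--                   false = r-state (acts real next time on the scale).
State : Set
State = Bool

fState rState : State
fState = true
rState = false

outcome : ∀ {N} → Weighing N → Fin N → State → Outcome
outcome w c s with place w c
... | off   = balance
... | left  = if s then leftLighter else balance
... | right = if s then rightLighter else balance

nextState : ∀ {N} → Weighing N → Fin N → State → State
nextState w c s with place w c
... | off   = s
... | left  = if s then false else true
... | right = if s then false else true

-- Adaptive strategies using at most d weighings (decision trees of depth ≤ d);
-- a leaf names the coin declared to be the alternator.
data Strategy (N : ℕ) : ℕ → Set where
  declare : ∀ {d} → Fin N → Strategy N d
  weigh   : ∀ {d} → Weighing N → (Outcome → Strategy N d) → Strategy N (suc d)

run : ∀ {N d} → Strategy N d → Fin N → State → Fin N
run (declare x) c s = x
run (weigh w k) c s = run (k (outcome w c s)) c (nextState w c s)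

-- f(N) ≤ d : some strategy with ≤ d weighings finds the alternator starting in the f-state.
FSolvable : ℕ → ℕ → Set
FSolvable N d = Σ (Strategy N d) λ t → ∀ c → run t c fState ≡ c

-- r(N) ≤ d
RSolvable : ℕ → ℕ → Set
RSolvable N d = Σ (Strategy N d) λ t → ∀ c → run t c rState ≡ c

-- a(N) ≤ d : works whatever the (unknown) initial state.
ASolvable : ℕ → ℕ → Set
ASolvable N d = Σ (Strategy N d) λ t → ∀ c s → run t c s ≡ c

-- Lower bounds: a strategy with d weighings has at most 3^d leaves, and every coin must be
-- declared at some leaf. An alternator in the r-state balances the first weighing whatever it
-- is, so only the balance subtree matters, which costs one weighing.
--
-- Upper bounds: weigh the same trisection twice. An alternator on the scale acts fake in
-- exactly one of the two weighings, whatever its state, and is back in its state afterwards;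
-- so the pair reveals the pan of the alternator (left, right or off), and k such pairs search
-- 3^k coins. From the f-state a single weighing already reveals the pan, which saves one
-- weighing at the end.

module Submission where

open import Defs
open import Data.Nat using (ℕ; zero; suc; _+_; _*_; _^_; _∸_; _≤_; _<_; z≤n; s≤s; _≤?_; _<?_)
open import Data.Nat.Properties
open import Data.Fin using (Fin; toℕ; fromℕ<) renaming (zero to fzero)
open import Data.Fin.Properties using (toℕ-injective; toℕ-fromℕ<; toℕ<n; pigeonhole)
  renaming (<⇒≢ to <⇒≢ᶠ)
open import Data.Bool using (Bool; true; false; if_then_else_)
open import Data.List using (List; []; _∷_; [_]; _++_; length; lookup)
open import Data.List.Properties using (length-++)
open import Data.List.Membership.Propositional using (_∈_)
open import Data.List.Membership.Propositional.Properties using (∈-++⁺ˡ; ∈-++⁺ʳ)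
open import Data.List.Relation.Unary.Any using (here; index)
open import Data.List.Relation.Unary.Any.Properties using (lookup-index)
open import Data.Product using (Σ-syntax; _×_; _,_; proj₁; proj₂)
open import Data.Unit using (tt)
open import Function using (_∘_)
open import Level using (0ℓ)
open import Relation.Nullary using (¬_; yes; no; contradiction)
open import Relation.Unary using (Pred; U; ｛_｝)
open import Relation.Binary.PropositionalEquality using (_≡_; refl; sym; trans; cong; cong₂; subst)

leaves : ∀ {N d} → Strategy N d → List (Fin N)
leaves (declare x) = [ x ]
leaves (weigh w k) = leaves (k balance) ++ leaves (k leftLighter) ++ leaves (k rightLighter)

length-leaves : ∀ {N d} (t : Strategy N d) → length (leaves t) ≤ 3 ^ d
length-leaves {d = d} (declare x) = m^n>0 3 d
length-leaves {d = suc d} (weigh w k) = begin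
  length (leaves (k balance) ++ leaves (k leftLighter) ++ leaves (k rightLighter))
    ≡⟨ length-++ (leaves (k balance)) ⟩
  length (leaves (k balance)) + length (leaves (k leftLighter) ++ leaves (k rightLighter))
    ≡⟨ cong (length (leaves (k balance)) +_) (length-++ (leaves (k leftLighter))) ⟩
  length (leaves (k balance)) + (length (leaves (k leftLighter)) + length (leaves (k rightLighter)))
    ≤⟨ +-mono-≤ (length-leaves (k balance))
         (+-mono-≤ (length-leaves (k leftLighter)) (m≤n⇒m≤n+o 0 (length-leaves (k rightLighter)))) ⟩
  3 ^ suc d ∎
  where open ≤-Reasoning

run∈leaves : ∀ {N d} (t : Strategy N d) c s → run t c s ∈ leaves t
run∈leaves (declare x) c s = here refl
run∈leaves (weigh w k) c s with outcome w c s
... | balance      = ∈-++⁺ˡ (run∈leaves (k balance) c _)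
... | leftLighter  = ∈-++⁺ʳ (leaves (k balance)) (∈-++⁺ˡ (run∈leaves (k leftLighter) c _))
... | rightLighter =
  ∈-++⁺ʳ (leaves (k balance)) (∈-++⁺ʳ (leaves (k leftLighter)) (run∈leaves (k rightLighter) c _))

enumeration⇒≤length : ∀ {N} (xs : List (Fin N)) → (∀ c → c ∈ xs) → N ≤ length xs
enumeration⇒≤length {N} xs ∈xs with N ≤? length xs
... | yes N≤ = N≤
... | no N≰ with pigeonhole (≰⇒> N≰) (index ∘ ∈xs)
...   | i , j , i<j , same-index = contradiction
  (trans (lookup-index (∈xs i)) (trans (cong (lookup xs) same-index) (sym (lookup-index (∈xs j)))))
  (<⇒≢ᶠ i<j)

found⇒≤length-leaves : ∀ {N d} (t : Strategy N d) (st : Fin N → State) →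
  (∀ c → run t c (st c) ≡ c) → N ≤ length (leaves t)
found⇒≤length-leaves t st found =
  enumeration⇒≤length (leaves t) (λ c → subst (_∈ leaves t) (found c) (run∈leaves t c (st c)))

found⇒≤3^depth : ∀ {N d} (t : Strategy N d) (st : Fin N → State) →
  (∀ c → run t c (st c) ≡ c) → N ≤ 3 ^ d
found⇒≤3^depth t st found = ≤-trans (found⇒≤length-leaves t st found) (length-leaves t)

outcome-rState : ∀ {N} (w : Weighing N) c → outcome w c rState ≡ balance
outcome-rState w c with place w c
... | left  = refl
... | right = refl
... | off   = refl

found-rState⇒≤3^pred-depth : ∀ {N d} (t : Strategy N d) →
  (∀ c → run t c rState ≡ c) → N ≤ 3 ^ (d ∸ 1)
found-rState⇒≤3^pred-depth {d = d} t@(declare _) found =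
  ≤-trans (found⇒≤length-leaves t (λ _ → rState) found) (m^n>0 3 (d ∸ 1))
found-rState⇒≤3^pred-depth (weigh w k) found =
  found⇒≤3^depth (k balance) (λ c → nextState w c rState)
    (λ c → subst (λ o → run (k o) c (nextState w c rState) ≡ c) (outcome-rState w c) (found c))

byPan : ∀ {A : Set} → Pan → A → A → A → A
byPan left  aˡ aʳ a⁰ = aˡ
byPan right aˡ aʳ a⁰ = aʳ
byPan off   aˡ aʳ a⁰ = a⁰

lighterPan : Outcome → Pan
lighterPan balance      = off
lighterPan leftLighter  = left
lighterPan rightLighter = right

_orElse_ : Outcome → Outcome → Outcome
balance orElse o = o
o       orElse _ = o

singleWeighing : ∀ {N d} → Weighing N → (tˡ tʳ t⁰ : Strategy N d) → Strategy N (1 + d)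
singleWeighing w tˡ tʳ t⁰ = weigh w λ o → byPan (lighterPan o) tˡ tʳ t⁰

doubleWeighing : ∀ {N d} → Weighing N → (tˡ tʳ t⁰ : Strategy N d) → Strategy N (2 + d)
doubleWeighing w tˡ tʳ t⁰ =
  weigh w λ o₁ → weigh w λ o₂ → byPan (lighterPan (o₁ orElse o₂)) tˡ tʳ t⁰

fState-reveals-pan : ∀ {N} (w : Weighing N) c → lighterPan (outcome w c fState) ≡ place w c
fState-reveals-pan w c with place w c
... | left  = refl
... | right = refl
... | off   = refl

double-reveals-pan : ∀ {N} (w : Weighing N) c s →
  lighterPan (outcome w c s orElse outcome w c (nextState w c s)) ≡ place w c
double-reveals-pan w c s with place w c | s
... | left  | true  = refl
... | left  | false = refl
... | right | true  = refl
... | right | false = refl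
... | off   | true  = refl
... | off   | false = refl

double-restores-state : ∀ {N} (w : Weighing N) c s → nextState w c (nextState w c s) ≡ s
double-restores-state w c s with place w c | s
... | left  | true  = refl
... | left  | false = refl
... | right | true  = refl
... | right | false = refl
... | off   | true  = refl
... | off   | false = refl

ThreeWayTest : ∀ {N d e} → Pred State 0ℓ → Pred State 0ℓ →
  (Weighing N → Strategy N d → Strategy N d → Strategy N d → Strategy N e) → Set
ThreeWayTest {N} {d} S S′ test = ∀ w (tˡ tʳ t⁰ : Strategy N d) c {s} → S s →
  Σ[ s′ ∈ State ] S′ s′ × run (test w tˡ tʳ t⁰) c s ≡ run (byPan (place w c) tˡ tʳ t⁰) c s′

singleWeighing-test : ∀ {N d} → ThreeWayTest {N} {d} ｛ fState ｝ U singleWeighing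
singleWeighing-test w tˡ tʳ t⁰ c refl = nextState w c fState , tt ,
  cong (λ p → run (byPan p tˡ tʳ t⁰) c (nextState w c fState)) (fState-reveals-pan w c)

doubleWeighing-test : ∀ {N d S} → ThreeWayTest {N} {d} S S doubleWeighing
doubleWeighing-test w tˡ tʳ t⁰ c {s} Ss = s , Ss ,
  cong₂ (λ p s′ → run (byPan p tˡ tʳ t⁰) c s′)
    (double-reveals-pan w c s) (double-restores-state w c s)

-- A layout lists consecutive runs of coins, each run placed on one pan; coins past the end are off.
Layout : Set
Layout = List (Pan × ℕ)

panAt : Layout → ℕ → Pan
panAt []                 x       = off
panAt ((p , zero)  ∷ ps) x       = panAt ps x
panAt ((p , suc m) ∷ ps) zero    = p
panAt ((p , suc m) ∷ ps) (suc x) = panAt ((p , m) ∷ ps) x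

panAt-head : ∀ p m ps {x} → x < m → panAt ((p , m) ∷ ps) x ≡ p
panAt-head p (suc m) ps {zero}  _          = refl
panAt-head p (suc m) ps {suc x} (s≤s x<m) = panAt-head p m ps x<m

panAt-skip : ∀ p m ps x → panAt ((p , m) ∷ ps) (m + x) ≡ panAt ps x
panAt-skip p zero    ps x = refl
panAt-skip p (suc m) ps x = panAt-skip p m ps x

weight : (Pan → Bool) → Layout → ℕ
weight q []             = 0
weight q ((p , m) ∷ ps) = (if q p then m else 0) + weight q ps

extent : Layout → ℕ
extent = weight (λ _ → true)

count-panAt : ∀ (q : Pan → Bool) → q off ≡ false → ∀ n ps → extent ps ≤ n →
  count {n} (λ i → q (panAt ps (toℕ i))) ≡ weight q ps
count-panAt q q-off zero    []  _ = refl
count-panAt q q-off (suc n) []  _ with q off | q-off | count-panAt q q-off n [] z≤n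
... | false | _  | rest = rest
... | true  | () | _
count-panAt q q-off n ((p , zero) ∷ ps) fits with q p | count-panAt q q-off n ps fits
... | true  | rest = rest
... | false | rest = rest
count-panAt q q-off (suc n) ((p , suc m) ∷ ps) (s≤s fits)
  with q p | count-panAt q q-off n ((p , m) ∷ ps) fits
... | true  | rest = cong suc rest
... | false | rest = rest

trisection : ℕ → ℕ → Layout
trisection lo a = (off , lo) ∷ (left , a) ∷ (right , a) ∷ []

trisectionWeighing : ∀ {N} lo a → lo + a + a ≤ N → Weighing N
trisectionWeighing {N} lo a lo+a+a≤N = weighing (λ i → panAt (trisection lo a) (toℕ i))
  (trans (count-panAt isLeft refl N (trisection lo a) fits)
    (sym (count-panAt isRight refl N (trisection lo a) fits)))
  where
  fits : extent (trisection lo a) ≤ N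
  fits = subst (_≤ N)
    (trans (+-assoc lo a a) (cong (λ x → lo + (a + x)) (sym (+-identityʳ a)))) lo+a+a≤N

trisection-left : ∀ lo a {y} → y < a → panAt (trisection lo a) (lo + y) ≡ left
trisection-left lo a y<a = trans (panAt-skip off lo _ _) (panAt-head left a _ y<a)

trisection-right : ∀ lo a {y} → y < a → panAt (trisection lo a) (lo + (a + y)) ≡ right
trisection-right lo a y<a =
  trans (panAt-skip off lo _ _) (trans (panAt-skip left a _ _) (panAt-head right a _ y<a))

trisection-off : ∀ lo a y → panAt (trisection lo a) (lo + (a + (a + y))) ≡ off
trisection-off lo a y =
  trans (panAt-skip off lo _ _) (trans (panAt-skip left a _ _) (panAt-skip right a [] y))

data Trisected (a b : ℕ) : ℕ → Set where
  inLeft  : ∀ {y} → y < a → Trisected a b y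
  inRight : ∀ {y} → y < a → Trisected a b (a + y)
  inOff   : ∀ {y} → y < b → Trisected a b (a + (a + y))

trisected : ∀ {a b y} → y < a + (a + b) → Trisected a b y
trisected {a} {b} {y} y< with y <? a
... | yes y<a = inLeft y<a
... | no y≮a with m≤n⇒∃[o]m+o≡n (≮⇒≥ y≮a)
...   | z , refl with z <? a
...     | yes z<a = inRight z<a
...     | no z≮a with m≤n⇒∃[o]m+o≡n (≮⇒≥ z≮a)
...       | w , refl = inOff (+-cancelˡ-< a w b (+-cancelˡ-< a (a + w) (a + b) y<))

trisect : ∀ {B m} → m ≤ 3 * B → Σ[ a ∈ ℕ ] Σ[ b ∈ ℕ ] a ≤ B × b ≤ B × a + (a + b) ≡ m
trisect {B} {m} m≤3B with m ≤? B
... | yes m≤B = 0 , m , z≤n , m≤B , refl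
... | no m≰B with m≤n⇒∃[o]m+o≡n (<⇒≤ (≰⇒> m≰B))
...   | r , refl with r ≤? B
...     | yes r≤B = r , B ∸ r , r≤B , m∸n≤m B r ,
          trans (cong (r +_) (m+[n∸m]≡n r≤B)) (+-comm r B)
...     | no r≰B with m≤n⇒∃[o]m+o≡n (<⇒≤ (≰⇒> r≰B))
...       | t , refl = B , t , ≤-refl ,
          +-cancelˡ-≤ B t B (+-cancelˡ-≤ B (B + t) (B + B) (subst (B + (B + t) ≤_)
            (cong (λ x → B + (B + x)) (+-identityʳ B)) m≤3B)) ,
          refl

FindsIn : ∀ {N d} → Pred State 0ℓ → Strategy N d → ℕ → ℕ → Set
FindsIn S t lo m = ∀ {s} → S s → ∀ c y → toℕ c ≡ lo + y → y < m → run t c s ≡ c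

IntervalSolver : ℕ → Pred State 0ℓ → ℕ → ℕ → Set
IntervalSolver N S d B = ∀ lo m → lo + m ≤ N → m ≤ B → Σ[ t ∈ Strategy N d ] FindsIn S t lo m

weaken-bound : ∀ {N S d B B′} → B′ ≤ B → IntervalSolver N S d B → IntervalSolver N S d B′
weaken-bound B′≤B solve lo m lo+m≤N m≤B′ = solve lo m lo+m≤N (≤-trans m≤B′ B′≤B)

declare-solver : ∀ {n S} → IntervalSolver (suc n) S 0 1
declare-solver lo zero _ _ = declare fzero , λ _ _ _ _ ()
declare-solver {n} {S} lo (suc zero) lo+1≤N _ = declare (fromℕ< lo<N) , found
  where
  lo<N : lo < suc n
  lo<N = subst (_≤ suc n) (+-comm lo 1) lo+1≤N
  found : FindsIn {d = 0} S (declare (fromℕ< lo<N)) lo 1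
  found _ c y c≡ (s≤s z≤n) =
    toℕ-injective (trans (toℕ-fromℕ< lo<N) (sym (trans c≡ (+-identityʳ lo))))
declare-solver lo (suc (suc m)) _ (s≤s ())

threeWay-solver : ∀ {N S S′ d e B}
  (test : Weighing N → Strategy N d → Strategy N d → Strategy N d → Strategy N e) →
  ThreeWayTest S S′ test → IntervalSolver N S′ d B → IntervalSolver N S e (3 * B)
threeWay-solver {N} {S} {S′} {d} {B = B} test test-ok solve lo m lo+m≤N m≤3B with trisect {B} m≤3B
... | a , b , a≤B , b≤B , refl = test w tˡ tʳ t⁰ , found
  where
  reassoc : ∀ z → lo + (a + (a + z)) ≡ lo + a + a + z
  reassoc z = sym (trans (+-assoc (lo + a) a z) (+-assoc lo a (a + z)))
  fits : lo + a + a + b ≤ N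
  fits = subst (_≤ N) (reassoc b) lo+m≤N
  fitsʳ : lo + a + a ≤ N
  fitsʳ = ≤-trans (m≤m+n (lo + a + a) b) fits
  w : Weighing N
  w = trisectionWeighing lo a fitsʳ
  solveˡ : Σ[ t ∈ Strategy N d ] FindsIn S′ t lo a
  solveˡ = solve lo a (≤-trans (m≤m+n (lo + a) a) fitsʳ) a≤B
  solveʳ : Σ[ t ∈ Strategy N d ] FindsIn S′ t (lo + a) a
  solveʳ = solve (lo + a) a fitsʳ a≤B
  solve⁰ : Σ[ t ∈ Strategy N d ] FindsIn S′ t (lo + a + a) b
  solve⁰ = solve (lo + a + a) b fits b≤B
  tˡ tʳ t⁰ : Strategy N d
  tˡ = proj₁ solveˡ
  tʳ = proj₁ solveʳ
  t⁰ = proj₁ solve⁰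
  via : ∀ {c s s′ p} → run (test w tˡ tʳ t⁰) c s ≡ run (byPan (place w c) tˡ tʳ t⁰) c s′ →
    place w c ≡ p → run (byPan p tˡ tʳ t⁰) c s′ ≡ c → run (test w tˡ tʳ t⁰) c s ≡ c
  via {c} {s′ = s′} test≡ place≡ found-p =
    trans test≡ (trans (cong (λ p → run (byPan p tˡ tʳ t⁰) c s′) place≡) found-p)
  found : FindsIn S (test w tˡ tʳ t⁰) lo (a + (a + b))
  found Ss c y c≡ y< with test-ok w tˡ tʳ t⁰ c Ss | trisected y<
  ... | _ , S′s′ , test≡ | inLeft y<a = via test≡
    (trans (cong (panAt (trisection lo a)) c≡) (trisection-left lo a y<a))
    (proj₂ solveˡ S′s′ c y c≡ y<a)
  ... | _ , S′s′ , test≡ | inRight {z} z<a = via test≡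
    (trans (cong (panAt (trisection lo a)) c≡) (trisection-right lo a z<a))
    (proj₂ solveʳ S′s′ c z (trans c≡ (sym (+-assoc lo a z))) z<a)
  ... | _ , S′s′ , test≡ | inOff {z} z<b = via test≡
    (trans (cong (panAt (trisection lo a)) c≡) (trisection-off lo a z))
    (proj₂ solve⁰ S′s′ c z (trans c≡ (reassoc z)) z<b)

iterate-doubleWeighing : ∀ {N S d B} j → IntervalSolver N S d B → IntervalSolver N S (j * 2 + d) (3 ^ j * B)
iterate-doubleWeighing {B = B} zero    solve = weaken-bound (≤-reflexive (*-identityˡ B)) solve
iterate-doubleWeighing {B = B} (suc j) solve = weaken-bound (≤-reflexive (*-assoc 3 (3 ^ j) B))
  (threeWay-solver doubleWeighing doubleWeighing-test (iterate-doubleWeighing j solve))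

solver⇒strategy : ∀ {N S d B} → IntervalSolver N S d B → N ≤ B →
  Σ[ t ∈ Strategy N d ] (∀ {s} → S s → ∀ c → run t c s ≡ c)
solver⇒strategy solve N≤B with solve 0 _ ≤-refl N≤B
... | t , found = t , λ Ss c → found Ss c (toℕ c) refl (toℕ<n c)

ASolvable⇒RSolvable : ∀ {N d} → ASolvable N d → RSolvable N d
ASolvable⇒RSolvable (t , found) = t , λ c → found c rState

ASolvable-≤3^ : ∀ {n} k → suc n ≤ 3 ^ k → ASolvable (suc n) (2 * k)
ASolvable-≤3^ {n} k N≤3^k
  with solver⇒strategy (iterate-doubleWeighing k declare-solver)
         (subst (suc n ≤_) (sym (*-identityʳ (3 ^ k))) N≤3^k)
... | t , found = subst (ASolvable _) (trans (+-identityʳ (k * 2)) (*-comm k 2)) (t , λ c s → found tt c)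

FSolvable-≤3^ : ∀ {n} k → suc n ≤ 3 ^ suc k → FSolvable (suc n) (2 * suc k ∸ 1)
FSolvable-≤3^ {n} k N≤3^[1+k]
  with solver⇒strategy
         (iterate-doubleWeighing k (threeWay-solver singleWeighing singleWeighing-test declare-solver))
         (subst (suc n ≤_) (*-comm 3 (3 ^ k)) N≤3^[1+k])
... | t , found = subst (FSolvable _) depth≡ (t , found refl)
  where
  depth≡ : k * 2 + 1 ≡ 2 * suc k ∸ 1
  depth≡ = trans (+-comm (k * 2) 1) (trans (cong suc (*-comm k 2)) (sym (+-suc k (k + 0))))

mainTheorem1 : (k N : ℕ) → 1 ≤ k → 3 ^ (k ∸ 1) < N → N ≤ 3 ^ k →
    ((¬ ASolvable N k) × ASolvable N (2 * k)) ×
    ((¬ RSolvable N k) × RSolvable N (2 * k)) ×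
    ((¬ FSolvable N (k ∸ 1)) × FSolvable N (2 * k ∸ 1))
mainTheorem1 zero    N       ()
mainTheorem1 (suc k) zero    _  ()
mainTheorem1 (suc k) (suc n) _  3^k<N N≤3^[1+k] =
  (notR ∘ ASolvable⇒RSolvable , A) ,
  (notR , ASolvable⇒RSolvable A) ,
  (notF , FSolvable-≤3^ k N≤3^[1+k])
  where
  A : ASolvable (suc n) (2 * suc k)
  A = ASolvable-≤3^ (suc k) N≤3^[1+k]
  notR : ¬ RSolvable (suc n) (suc k)
  notR (t , found) = <⇒≱ 3^k<N (found-rState⇒≤3^pred-depth t found)
  notF : ¬ FSolvable (suc n) k
  notF (t , found) = <⇒≱ 3^k<N (found⇒≤3^depth t _ found)
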